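{- Let $G$ be a finite group with $|G|\ge 3$, $\Gamma_G$ its power graph and $M_G$ the set of maximal involutions of $G$. If $|M_G|=1$, then $\mathrm{rc}(\Gamma_G)=3$.
   Context: For a finite group $G$ with identity $e$, the power graph $\Gamma_G$ is the undirected graph with vertex set $G$ in which two distinct elements are adjacent if one is a power of the other. An involution is an element of order $2$. An involution $x$ is maximal if the only cyclic subgroup of $G$ containing $x$ is $\langle x\rangle$; $M_G$ denotes the set of maximal involutions of $G$. For a connected graph $\Gamma$, an edge coloring $\zeta:E(\Gamma)\to\{1,\dots,k\}$ (adjacent edges may receive the same color) is a rainbow $k$-coloring if every pair of vertices is joined by a path whose edges have pairwise distinct colors; the rainbow connection number $\mathrm{rc}(\Gamma)$ is the minimum $k$ for which a rainbow $k$-coloring exists. -}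

module Defs where

open import Level using (0ℓ)
open import Data.Nat using (ℕ; zero; suc; _<_)
open import Data.Fin using (Fin)
open import Data.List using (List; []; _∷_)
open import Data.List.Relation.Unary.Unique.Propositional using (Unique)
open import Data.Product using (Σ; ∃; _×_; _,_)
open import Data.Sum using (_⊎_)
open import Relation.Nullary using (¬_)
open import Relation.Binary.PropositionalEquality using (_≡_; _≢_)
open import Algebra.Structures using (IsGroup)

-- A finite group, presented (up to isomorphism) on the carrier Fin order.
record FinGroup : Set where
  field
    order   : ℕ
    _∙_     : Fin order → Fin order → Fin order
    ε       : Fin order
    _⁻¹     : Fin order → Fin order
    isGroup : IsGroup _≡_ _∙_ ε _⁻¹

  _^_ : Fin order → ℕ → Fin order
  x ^ zero  = ε
  x ^ suc k = x ∙ (x ^ k)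

  -- y is a power of x (y ∈ ⟨x⟩; in a finite group ℕ-powers suffice)
  IsPowerOf : Fin order → Fin order → Set
  IsPowerOf y x = ∃ λ k → y ≡ x ^ k

  PowerAdj : Fin order → Fin order → Set
  PowerAdj x y = x ≢ y × (IsPowerOf x y ⊎ IsPowerOf y x)

  IsInvolution : Fin order → Set
  IsInvolution x = x ≢ ε × (x ∙ x) ≡ ε

  -- x is a maximal involution: every cyclic subgroup ⟨y⟩ containing x equals ⟨x⟩
  -- (x ∈ ⟨y⟩ and ⟨y⟩ ⊆ ⟨x⟩, i.e. y ∈ ⟨x⟩)
  IsMaximalInvolution : Fin order → Set
  IsMaximalInvolution x =
    IsInvolution x × (∀ y → IsPowerOf x y → IsPowerOf y x)

  UniqueMaximalInvolution : Set
  UniqueMaximalInvolution =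
    ∃ λ x → IsMaximalInvolution x × (∀ y → IsMaximalInvolution y → y ≡ x)

data Walk {n : ℕ} (Adj : Fin n → Fin n → Set) : Fin n → Fin n → Set where
  stop : ∀ {u} → Walk Adj u u
  step : ∀ {u w v} → Adj u w → Walk Adj w v → Walk Adj u v

module _ {n : ℕ} {Adj : Fin n → Fin n → Set} where
  vertices : ∀ {u v} → Walk Adj u v → List (Fin n)
  vertices {u} stop       = u ∷ []
  vertices {u} (step _ p) = u ∷ vertices p

  edgeColours : ∀ {k u v} → (Fin n → Fin n → Fin k) → Walk Adj u v → List (Fin k)
  edgeColours c stop               = []
  edgeColours c (step {u} {w} _ p) = c u w ∷ edgeColours c p

-- Edge colourings with k colours: a colour for each (unordered) edge,
-- represented as a symmetric function on pairs (values on non-edges irrelevant).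
IsEdgeColouring : {n k : ℕ} → (Fin n → Fin n → Set) → (Fin n → Fin n → Fin k) → Set
IsEdgeColouring {n} Adj c = ∀ u v → Adj u v → c u v ≡ c v u

IsRainbowColouring : {n k : ℕ} → (Fin n → Fin n → Set) → (Fin n → Fin n → Fin k) → Set
IsRainbowColouring {n} Adj c =
  IsEdgeColouring Adj c ×
  (∀ u v → Σ (Walk Adj u v) λ p → Unique (vertices p) × Unique (edgeColours c p))

RainbowColourable : {n : ℕ} → (Fin n → Fin n → Set) → ℕ → Set
RainbowColourable {n} Adj k = ∃ λ (c : Fin n → Fin n → Fin k) → IsRainbowColouring Adj c

RainbowConnectionNumberIs : {n : ℕ} → (Fin n → Fin n → Set) → ℕ → Set
RainbowConnectionNumberIs Adj r =
  RainbowColourable Adj r × (∀ k → k < r → ¬ RainbowColourable Adj k)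

module Submission where

-- Lower bound.  x is central, because conjugation is an automorphism and
-- automorphisms permute the maximal involutions.  Every element g ∉ {ε, x}
-- has some power that is an involution y ≠ x (an odd order of g would put
-- x in the cyclic group ⟨x g⟩ ≠ ⟨x⟩), and z = x y is a third involution.
-- In Γ_G the only neighbour of x is ε, and ε is the only common neighbour
-- of y and z.  A rainbow path with at most two colours has length at most
-- two, so the pairs (x,y), (x,z), (y,z) force the edges ε–x, ε–y, ε–z to
-- receive three different colours.
--
-- Colour every edge not at ε with 0, the edge ε–x with 0, and
-- an edge ε–v with 1 or 2 according to an orientation of the pair {v, v⁻¹}
-- that separates v from v⁻¹.  Two vertices u, v ∉ {ε, x} of equal
-- orientation are joined by u–w–ε–v, where w is a neighbour of u of the
-- opposite orientation: u⁻¹, or, for an involution u (not maximal, since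
-- u ≠ x), a generator g or g⁻¹ of a cyclic group strictly above ⟨u⟩.

open import Defs
open import Level using (0ℓ)
open import Data.Nat using (ℕ; zero; suc; _+_; _*_; _∸_; _≤_; _<_; s≤s)
import Data.Nat.Properties as ℕP
open import Data.Nat.DivMod using (_%_; _/_; m≡m%n+[m/n]*n; m%n<n)
open import Data.Nat.Induction using (<-rec)
open import Data.Fin as F using (Fin; toℕ; fromℕ<)
import Data.Fin.Properties as FP
open import Data.Product using (∃; Σ; _×_; _,_; proj₁; proj₂)
open import Data.Sum using (_⊎_; inj₁; inj₂; [_,_])
open import Data.Empty using (⊥; ⊥-elim)
open import Data.List using ([]; _∷_)
open import Data.List.Relation.Unary.All using ([]; _∷_)
open import Data.List.Relation.Unary.AllPairs using ([]; _∷_)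
open import Data.List.Relation.Unary.Unique.Propositional using (Unique)
open import Function using (_∘_; id)
open import Relation.Nullary using (¬_; Dec; yes; no)
open import Relation.Nullary.Decidable using (_→-dec_)
open import Relation.Binary.PropositionalEquality
  using (_≡_; _≢_; refl; sym; trans; cong; cong₂; subst; module ≡-Reasoning)
open import Algebra.Bundles using (Group)
open import Algebra.Structures using (IsGroup)
import Algebra.Properties.Group as GroupProperties

-- Fin k with k ≤ 2 contains no three pairwise distinct elements; this is
-- why a rainbow path with at most two colours has at most two edges.
noThreeDistinct : ∀ {k} → k ≤ 2 → (a b c : Fin k) → a ≢ b → a ≢ c → b ≢ c → ⊥
noThreeDistinct _ F.zero F.zero _ a≢b _ _ = a≢b refl
noThreeDistinct _ (F.suc F.zero) (F.suc F.zero) _ a≢b _ _ = a≢b refl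
noThreeDistinct _ F.zero (F.suc F.zero) F.zero _ a≢c _ = a≢c refl
noThreeDistinct _ F.zero (F.suc F.zero) (F.suc F.zero) _ _ b≢c = b≢c refl
noThreeDistinct _ (F.suc F.zero) F.zero F.zero _ _ b≢c = b≢c refl
noThreeDistinct _ (F.suc F.zero) F.zero (F.suc F.zero) _ a≢c _ = a≢c refl
noThreeDistinct {suc (suc (suc _))} (s≤s (s≤s ())) (F.suc (F.suc _)) _ _ _ _ _
noThreeDistinct {suc (suc (suc _))} (s≤s (s≤s ())) _ (F.suc (F.suc _)) _ _ _ _
noThreeDistinct {suc (suc (suc _))} (s≤s (s≤s ())) _ _ (F.suc (F.suc _)) _ _ _

avoidTwo : ∀ {n} → 3 ≤ n → (a b : Fin n) → ∃ λ c → c ≢ a × c ≢ b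
avoidTwo (s≤s (s≤s (s≤s _))) = pick
  where
  pick : ∀ {m} (a b : Fin (suc (suc (suc m)))) → ∃ λ c → c ≢ a × c ≢ b
  pick F.zero F.zero = F.suc F.zero , (λ ()) , (λ ())
  pick F.zero (F.suc F.zero) = F.suc (F.suc F.zero) , (λ ()) , (λ ())
  pick F.zero (F.suc (F.suc _)) = F.suc F.zero , (λ ()) , (λ ())
  pick (F.suc F.zero) F.zero = F.suc (F.suc F.zero) , (λ ()) , (λ ())
  pick (F.suc (F.suc _)) F.zero = F.suc F.zero , (λ ()) , (λ ())
  pick (F.suc _) (F.suc _) = F.zero , (λ ()) , (λ ())

halve : ∀ m → ∃ λ M → m ≡ M + M ⊎ m ≡ suc (M + M)
halve zero = 0 , inj₁ refl
halve (suc m) with halve m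
... | M , inj₁ m≡2M = M , inj₂ (cong suc m≡2M)
... | M , inj₂ m≡2M+1 = suc M , inj₁ (cong suc (trans m≡2M+1 (sym (ℕP.+-suc M M))))

below : ℕ → ℕ → Fin 2
below a b with a ℕP.<? b
... | yes _ = F.zero
... | no _ = F.suc F.zero

below-flip : ∀ {a b} → a ≢ b → below a b ≢ below b a
below-flip {a} {b} a≢b with a ℕP.<? b | b ℕP.<? a
... | yes a<b | yes b<a = ⊥-elim (ℕP.<-asym a<b b<a)
... | yes _ | no _ = λ ()
... | no _ | yes _ = λ ()
... | no a≮b | no b≮a = ⊥-elim (a≢b (ℕP.≤-antisym (ℕP.≮⇒≥ b≮a) (ℕP.≮⇒≥ a≮b)))

module _ {A : Set} where
  unique₁ : ∀ {a : A} → Unique (a ∷ [])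
  unique₁ = [] ∷ []

  unique₂ : ∀ {a b : A} → a ≢ b → Unique (a ∷ b ∷ [])
  unique₂ a≢b = (a≢b ∷ []) ∷ unique₁

  unique₃ : ∀ {a b c : A} → a ≢ b → a ≢ c → b ≢ c → Unique (a ∷ b ∷ c ∷ [])
  unique₃ a≢b a≢c b≢c = (a≢b ∷ a≢c ∷ []) ∷ unique₂ b≢c

  unique₄ : ∀ {a b c d : A} → a ≢ b → a ≢ c → a ≢ d → b ≢ c → b ≢ d → c ≢ d →
            Unique (a ∷ b ∷ c ∷ d ∷ [])
  unique₄ a≢b a≢c a≢d b≢c b≢d c≢d = (a≢b ∷ a≢c ∷ a≢d ∷ []) ∷ unique₃ b≢c b≢d c≢d

module Hub {n : ℕ} (Adj : Fin n → Fin n → Set) (h : Fin n) where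

  OnlyThroughHub : Fin n → Fin n → Set
  OnlyThroughHub u v = u ≢ v × ¬ Adj u v × (∀ {w} → Adj u w → Adj w v → w ≡ h)

  -- With at most two colours, a rainbow u–v walk is u–h–v, so the edges
  -- u–h and h–v have different colours.
  hub-colours-differ : ∀ {k u v} → k ≤ 2 → (c : Fin n → Fin n → Fin k) →
    OnlyThroughHub u v → (p : Walk Adj u v) → Unique (edgeColours c p) → c u h ≢ c h v
  hub-colours-differ _ c (u≢v , _ , _) stop _ = ⊥-elim (u≢v refl)
  hub-colours-differ _ c (_ , ¬adj , _) (step adj stop) _ = ⊥-elim (¬adj adj)
  hub-colours-differ _ c (_ , _ , common) (step adj₁ (step adj₂ stop)) ((c₁≢c₂ ∷ []) ∷ _)
    with common adj₁ adj₂
  ... | refl = c₁≢c₂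
  hub-colours-differ k≤2 c _ (step _ (step _ (step _ _)))
    ((c₁≢c₂ ∷ c₁≢c₃ ∷ _) ∷ (c₂≢c₃ ∷ _) ∷ _) = ⊥-elim (noThreeDistinct k≤2 _ _ _ c₁≢c₂ c₁≢c₃ c₂≢c₃)

module GroupFacts (G : FinGroup) where
  open FinGroup G public
  open IsGroup isGroup public using (assoc; identityˡ; identityʳ; inverseʳ)

  group : Group 0ℓ 0ℓ
  group = record { isGroup = isGroup }

  open GroupProperties group public
    using (∙-cancelˡ; ∙-cancelʳ; ⁻¹-involutive; inverseʳ-unique; ε⁻¹≈ε; ⁻¹-anti-homo-∙;
           \\-leftDividesʳ; //-rightDividesˡ)
  open ≡-Reasoning

  ^-+ : ∀ a i j → a ^ (i + j) ≡ (a ^ i) ∙ (a ^ j)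
  ^-+ a zero j = sym (identityˡ _)
  ^-+ a (suc i) j = trans (cong (a ∙_) (^-+ a i j)) (sym (assoc _ _ _))

  ^-multiple : ∀ a m → a ^ m ≡ ε → ∀ q → a ^ (q * m) ≡ ε
  ^-multiple a m aᵐ≡ε zero = refl
  ^-multiple a m aᵐ≡ε (suc q) = begin
    a ^ (m + q * m)           ≡⟨ ^-+ a m (q * m) ⟩
    (a ^ m) ∙ (a ^ (q * m))   ≡⟨ cong₂ _∙_ aᵐ≡ε (^-multiple a m aᵐ≡ε q) ⟩
    ε ∙ ε                     ≡⟨ identityˡ ε ⟩
    ε                         ∎

  commutes-^ : ∀ {a b} → (b ∙ a) ≡ (a ∙ b) → ∀ k → (b ∙ (a ^ k)) ≡ ((a ^ k) ∙ b)
  commutes-^ {a} {b} ba≡ab zero = trans (identityʳ b) (sym (identityˡ b))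
  commutes-^ {a} {b} ba≡ab (suc k) = begin
    b ∙ (a ∙ (a ^ k))   ≡⟨ sym (assoc b a _) ⟩
    (b ∙ a) ∙ (a ^ k)   ≡⟨ cong (_∙ (a ^ k)) ba≡ab ⟩
    (a ∙ b) ∙ (a ^ k)   ≡⟨ assoc a b _ ⟩
    a ∙ (b ∙ (a ^ k))   ≡⟨ cong (a ∙_) (commutes-^ ba≡ab k) ⟩
    a ∙ ((a ^ k) ∙ b)   ≡⟨ sym (assoc a _ b) ⟩
    (a ∙ (a ^ k)) ∙ b   ∎

  ^-∙ : ∀ {a b} → (b ∙ a) ≡ (a ∙ b) → ∀ k → (a ∙ b) ^ k ≡ (a ^ k) ∙ (b ^ k)
  ^-∙ ba≡ab zero = sym (identityˡ ε)
  ^-∙ {a} {b} ba≡ab (suc k) = begin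
    (a ∙ b) ∙ ((a ∙ b) ^ k)             ≡⟨ cong ((a ∙ b) ∙_) (^-∙ ba≡ab k) ⟩
    (a ∙ b) ∙ ((a ^ k) ∙ (b ^ k))       ≡⟨ assoc a b _ ⟩
    a ∙ (b ∙ ((a ^ k) ∙ (b ^ k)))       ≡⟨ cong (a ∙_) (sym (assoc b _ _)) ⟩
    a ∙ ((b ∙ (a ^ k)) ∙ (b ^ k))       ≡⟨ cong (λ t → a ∙ (t ∙ (b ^ k))) (commutes-^ ba≡ab k) ⟩
    a ∙ (((a ^ k) ∙ b) ∙ (b ^ k))       ≡⟨ cong (a ∙_) (assoc _ b _) ⟩
    a ∙ ((a ^ k) ∙ (b ∙ (b ^ k)))       ≡⟨ sym (assoc a _ _) ⟩
    (a ∙ (a ^ k)) ∙ (b ∙ (b ^ k))       ∎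

  ^-⁻¹ : ∀ a k → (a ^ k) ⁻¹ ≡ (a ⁻¹) ^ k
  ^-⁻¹ a zero = ε⁻¹≈ε
  ^-⁻¹ a (suc k) = begin
    (a ∙ (a ^ k)) ⁻¹            ≡⟨ ⁻¹-anti-homo-∙ a (a ^ k) ⟩
    ((a ^ k) ⁻¹) ∙ (a ⁻¹)       ≡⟨ cong (_∙ (a ⁻¹)) (^-⁻¹ a k) ⟩
    ((a ⁻¹) ^ k) ∙ (a ⁻¹)       ≡⟨ sym (commutes-^ refl k) ⟩
    (a ⁻¹) ∙ ((a ⁻¹) ^ k)       ∎

  -- Every element has finite order: two of ε, a, …, a^|G| coincide.
  period : ∀ a → ∃ λ m → a ^ suc m ≡ ε
  period a with FP.pigeonhole (ℕP.n<1+n order) (λ i → a ^ toℕ i)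
  ... | i , j , i<j , aⁱ≡aʲ = d , ∙-cancelˡ (a ^ toℕ i) _ _ (begin
      (a ^ toℕ i) ∙ (a ^ suc d)   ≡⟨ sym (^-+ a (toℕ i) (suc d)) ⟩
      a ^ (toℕ i + suc d)         ≡⟨ cong (a ^_) (trans (ℕP.+-suc (toℕ i) d) (ℕP.m+[n∸m]≡n i<j)) ⟩
      a ^ toℕ j                   ≡⟨ sym aⁱ≡aʲ ⟩
      a ^ toℕ i                   ≡⟨ sym (identityʳ _) ⟩
      (a ^ toℕ i) ∙ ε             ∎)
    where d = toℕ j ∸ suc (toℕ i)

  ^-mod : ∀ a m → a ^ suc m ≡ ε → ∀ k → a ^ k ≡ a ^ (k % suc m)
  ^-mod a m aᵐ⁺¹≡ε k = begin
    a ^ k                                           ≡⟨ cong (a ^_) (m≡m%n+[m/n]*n k (suc m)) ⟩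
    a ^ (r + q * suc m)                             ≡⟨ ^-+ a r (q * suc m) ⟩
    (a ^ r) ∙ (a ^ (q * suc m))                     ≡⟨ cong ((a ^ r) ∙_) (^-multiple a (suc m) aᵐ⁺¹≡ε q) ⟩
    (a ^ r) ∙ ε                                     ≡⟨ identityʳ _ ⟩
    a ^ r                                           ∎
    where
    r = k % suc m
    q = k / suc m

  -- Membership in a cyclic subgroup is decidable: only exponents below a
  -- period need to be tried.
  powerOf? : ∀ b a → Dec (IsPowerOf b a)
  powerOf? b a with period a
  ... | m , aᵐ⁺¹≡ε with FP.any? {n = suc m} (λ i → b FP.≟ (a ^ toℕ i))
  ...   | yes (i , b≡aⁱ) = yes (toℕ i , b≡aⁱ)
  ...   | no none = no λ (k , b≡aᵏ) → none (reduced k , trans b≡aᵏ (reduce k))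
    where
    reduced : ℕ → Fin (suc m)
    reduced k = fromℕ< (m%n<n k (suc m))

    reduce : ∀ k → a ^ k ≡ a ^ toℕ (reduced k)
    reduce k = trans (^-mod a m aᵐ⁺¹≡ε k) (cong (a ^_) (sym (FP.toℕ-fromℕ< (m%n<n k (suc m)))))

  inverse-is-power : ∀ a → IsPowerOf (a ⁻¹) a
  inverse-is-power a with period a
  ... | m , aᵐ⁺¹≡ε = m , sym (inverseʳ-unique a (a ^ m) aᵐ⁺¹≡ε)

  power-∙ : ∀ {a b w} → IsPowerOf a w → IsPowerOf b w → IsPowerOf (a ∙ b) w
  power-∙ {w = w} (i , refl) (j , refl) = i + j , sym (^-+ w i j)

  power-⁻¹ : ∀ {a b} → IsPowerOf b a → IsPowerOf (b ⁻¹) (a ⁻¹)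
  power-⁻¹ {a} (k , refl) = k , ^-⁻¹ a k

  ⁻¹-fixed : ∀ {a b} → b ⁻¹ ≡ b → a ⁻¹ ≡ b → a ≡ b
  ⁻¹-fixed {a} {b} b⁻¹≡b a⁻¹≡b =
    trans (sym (⁻¹-involutive a)) (trans (cong _⁻¹ a⁻¹≡b) b⁻¹≡b)

  ⁻¹-≢ : ∀ {a b} → b ⁻¹ ≡ b → a ≢ b → a ⁻¹ ≢ b
  ⁻¹-≢ b⁻¹≡b a≢b = a≢b ∘ ⁻¹-fixed b⁻¹≡b

  involution-^ : ∀ {a} → (a ∙ a) ≡ ε → ∀ k → a ^ k ≡ ε ⊎ a ^ k ≡ a
  involution-^ aa zero = inj₁ refl
  involution-^ {a} aa (suc k) with involution-^ aa k
  ... | inj₁ aᵏ≡ε = inj₂ (trans (cong (a ∙_) aᵏ≡ε) (identityʳ a))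
  ... | inj₂ aᵏ≡a = inj₁ (trans (cong (a ∙_) aᵏ≡a) aa)

  involution-powers : ∀ {a b} → (a ∙ a) ≡ ε → IsPowerOf b a → b ≡ ε ⊎ b ≡ a
  involution-powers aa (k , refl) = involution-^ aa k

  involution-power-ε : ∀ {a b} → (a ∙ a) ≡ ε → b ≢ a → IsPowerOf b a → b ≡ ε
  involution-power-ε aa b≢a b∈⟨a⟩ = [ id , ⊥-elim ∘ b≢a ] (involution-powers aa b∈⟨a⟩)

  involution-even-power : ∀ {a} → (a ∙ a) ≡ ε → ∀ M → a ^ (M + M) ≡ ε
  involution-even-power {a} aa M with involution-^ aa M
  ... | inj₁ aᴹ≡ε = trans (^-+ a M M) (trans (cong₂ _∙_ aᴹ≡ε aᴹ≡ε) (identityˡ ε))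
  ... | inj₂ aᴹ≡a = trans (^-+ a M M) (trans (cong₂ _∙_ aᴹ≡a aᴹ≡a) aa)

  involution-self-inverse : ∀ {a} → (a ∙ a) ≡ ε → a ⁻¹ ≡ a
  involution-self-inverse {a} aa = sym (inverseʳ-unique a a aa)

  -- Every element has odd order, or one of its powers is an involution:
  -- halve an even period as long as the half-power is still ε.
  oddPeriodOrInvolution : ∀ a m → a ^ suc m ≡ ε →
    (∃ λ M → a ^ suc (M + M) ≡ ε) ⊎ (∃ λ k → IsInvolution (a ^ k))
  oddPeriodOrInvolution a = <-rec Goal descend
    where
    Goal : ℕ → Set
    Goal m = a ^ suc m ≡ ε → (∃ λ M → a ^ suc (M + M) ≡ ε) ⊎ (∃ λ k → IsInvolution (a ^ k))

    descend : ∀ m → (∀ {m'} → m' < m → Goal m') → Goal m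
    descend m smaller aᵐ⁺¹≡ε with halve m
    ... | M , inj₁ m≡2M = inj₁ (M , subst (λ t → a ^ suc t ≡ ε) m≡2M aᵐ⁺¹≡ε)
    ... | M , inj₂ m≡2M+1 with (a ^ suc M) FP.≟ ε
    ...   | yes aᴹ⁺¹≡ε = smaller (subst (M <_) (sym m≡2M+1) (s≤s (ℕP.m≤m+n M M))) aᴹ⁺¹≡ε
    ...   | no aᴹ⁺¹≢ε = inj₂ (suc M , aᴹ⁺¹≢ε ,
              trans (sym (^-+ a (suc M) (suc M)))
                (trans (cong (λ t → a ^ suc t) (trans (ℕP.+-suc M M) (sym m≡2M+1))) aᵐ⁺¹≡ε))

  IsEndomorphism : (Fin order → Fin order) → Set
  IsEndomorphism φ = ∀ a b → φ (a ∙ b) ≡ (φ a) ∙ (φ b)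

  endo-ε : ∀ {φ} → IsEndomorphism φ → φ ε ≡ ε
  endo-ε {φ} φ-∙ = ∙-cancelˡ (φ ε) (φ ε) ε (begin
    (φ ε) ∙ (φ ε)   ≡⟨ sym (φ-∙ ε ε) ⟩
    φ (ε ∙ ε)       ≡⟨ cong φ (identityˡ ε) ⟩
    φ ε             ≡⟨ sym (identityʳ (φ ε)) ⟩
    (φ ε) ∙ ε       ∎)

  endo-^ : ∀ {φ} → IsEndomorphism φ → ∀ a k → φ (a ^ k) ≡ (φ a) ^ k
  endo-^ φ-∙ a zero = endo-ε φ-∙
  endo-^ {φ} φ-∙ a (suc k) = trans (φ-∙ a (a ^ k)) (cong ((φ a) ∙_) (endo-^ φ-∙ a k))

  -- An automorphism φ (with inverse ψ) maps maximal involutions to maximal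
  -- involutions: cyclic subgroups above φ a are images of those above a.
  automorphism-maximal : ∀ {φ ψ} → IsEndomorphism φ → IsEndomorphism ψ →
    (∀ v → ψ (φ v) ≡ v) → (∀ v → φ (ψ v) ≡ v) →
    ∀ {a} → IsMaximalInvolution a → IsMaximalInvolution (φ a)
  automorphism-maximal {φ} {ψ} φ-∙ ψ-∙ ψφ φψ {a} ((a≢ε , aa) , a-max) =
    (φa≢ε , φa-square) , φa-max
    where
    φa≢ε : φ a ≢ ε
    φa≢ε φa≡ε = a≢ε (trans (sym (ψφ a)) (trans (cong ψ φa≡ε) (endo-ε ψ-∙)))

    φa-square : ((φ a) ∙ (φ a)) ≡ ε
    φa-square = trans (sym (φ-∙ a a)) (trans (cong φ aa) (endo-ε φ-∙))

    φa-max : ∀ y → IsPowerOf (φ a) y → IsPowerOf y (φ a)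
    φa-max y (k , φa≡yᵏ) with a-max (ψ y) (k , trans (sym (ψφ a)) (trans (cong ψ φa≡yᵏ) (endo-^ ψ-∙ y k)))
    ... | j , ψy≡aʲ = j , trans (sym (φψ y)) (trans (cong φ ψy≡aʲ) (endo-^ φ-∙ a j))

  conj : Fin order → Fin order → Fin order
  conj g v = g ∙ (v ∙ (g ⁻¹))

  conj-endo : ∀ g → IsEndomorphism (conj g)
  conj-endo g a b = sym (begin
    (g ∙ (a ∙ (g ⁻¹))) ∙ (g ∙ (b ∙ (g ⁻¹)))     ≡⟨ assoc g _ _ ⟩
    g ∙ ((a ∙ (g ⁻¹)) ∙ (g ∙ (b ∙ (g ⁻¹))))     ≡⟨ cong (g ∙_) (assoc a _ _) ⟩
    g ∙ (a ∙ ((g ⁻¹) ∙ (g ∙ (b ∙ (g ⁻¹)))))     ≡⟨ cong (λ t → g ∙ (a ∙ t)) (\\-leftDividesʳ g _) ⟩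
    g ∙ (a ∙ (b ∙ (g ⁻¹)))                      ≡⟨ cong (g ∙_) (sym (assoc a b _)) ⟩
    g ∙ ((a ∙ b) ∙ (g ⁻¹))                      ∎)

  conj-cancel : ∀ g v → conj (g ⁻¹) (conj g v) ≡ v
  conj-cancel g v = begin
    (g ⁻¹) ∙ ((g ∙ (v ∙ (g ⁻¹))) ∙ ((g ⁻¹) ⁻¹))   ≡⟨ cong (λ t → (g ⁻¹) ∙ ((g ∙ (v ∙ (g ⁻¹))) ∙ t)) (⁻¹-involutive g) ⟩
    (g ⁻¹) ∙ ((g ∙ (v ∙ (g ⁻¹))) ∙ g)             ≡⟨ cong ((g ⁻¹) ∙_) (assoc g _ g) ⟩
    (g ⁻¹) ∙ (g ∙ ((v ∙ (g ⁻¹)) ∙ g))             ≡⟨ \\-leftDividesʳ g _ ⟩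
    (v ∙ (g ⁻¹)) ∙ g                              ≡⟨ //-rightDividesˡ g v ⟩
    v                                             ∎

  conj-maximal : ∀ g {a} → IsMaximalInvolution a → IsMaximalInvolution (conj g a)
  conj-maximal g = automorphism-maximal (conj-endo g) (conj-endo (g ⁻¹)) (conj-cancel g) cancel′
    where
    cancel′ : ∀ v → conj g (conj (g ⁻¹) v) ≡ v
    cancel′ v = subst (λ t → conj t (conj (g ⁻¹) v) ≡ v) (⁻¹-involutive g) (conj-cancel (g ⁻¹) v)

  -- Where a maximal involution a sits in Γ_G: the cyclic subgroups above a
  -- are ⟨a⟩ = {ε, a}, so its only neighbour is ε.
  maximal-overgroups : ∀ {a b} → IsMaximalInvolution a → IsPowerOf a b → b ≡ ε ⊎ b ≡ a
  maximal-overgroups ((_ , aa) , a-max) a∈⟨b⟩ = involution-powers aa (a-max _ a∈⟨b⟩)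

  maximal-involution-neighbour : ∀ {a w} → IsMaximalInvolution a → PowerAdj a w → w ≡ ε
  maximal-involution-neighbour ((_ , aa) , a-max) (a≢w , inj₁ a∈⟨w⟩) =
    involution-power-ε aa (a≢w ∘ sym) (a-max _ a∈⟨w⟩)
  maximal-involution-neighbour ((_ , aa) , _) (a≢w , inj₂ w∈⟨a⟩) =
    involution-power-ε aa (a≢w ∘ sym) w∈⟨a⟩

  involutions-nonadjacent : ∀ {y z} → IsInvolution y → IsInvolution z → ¬ PowerAdj y z
  involutions-nonadjacent (y≢ε , _) (_ , zz) (y≢z , inj₁ y∈⟨z⟩) = y≢ε (involution-power-ε zz y≢z y∈⟨z⟩)
  involutions-nonadjacent (_ , yy) (z≢ε , _) (y≢z , inj₂ z∈⟨y⟩) = z≢ε (involution-power-ε yy (y≢z ∘ sym) z∈⟨y⟩)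

  -- If y ≠ x and z are involutions whose product z y is a maximal involution
  -- x, then ε is the only common neighbour of y and z: a cyclic group ⟨w⟩
  -- containing y and z contains x, hence w ∈ {ε, x}, and w = x would put y
  -- into ⟨x⟩ = {ε, x}.
  common-neighbour : ∀ {x y z w} → IsMaximalInvolution x → IsInvolution y → IsInvolution z →
    y ≢ x → (z ∙ y) ≡ x → PowerAdj y w → PowerAdj w z → w ≡ ε
  common-neighbour _ (_ , yy) _ _ _ (y≢w , inj₂ w∈⟨y⟩) _ = involution-power-ε yy (y≢w ∘ sym) w∈⟨y⟩
  common-neighbour _ _ (_ , zz) _ _ _ (w≢z , inj₁ w∈⟨z⟩) = involution-power-ε zz w≢z w∈⟨z⟩
  common-neighbour {x} {y} {z} {w} x-max (y≢ε , _) _ y≢x zy≡x (_ , inj₁ y∈⟨w⟩) (_ , inj₂ z∈⟨w⟩)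
    with maximal-overgroups x-max (subst (λ t → IsPowerOf t w) zy≡x (power-∙ z∈⟨w⟩ y∈⟨w⟩))
  ... | inj₁ w≡ε = w≡ε
  ... | inj₂ refl = ⊥-elim ([ y≢ε , y≢x ] (involution-powers (proj₂ (proj₁ x-max)) y∈⟨w⟩))

  properOvergroup : ∀ u → ¬ (∀ g → IsPowerOf u g → IsPowerOf g u) →
    ∃ λ g → IsPowerOf u g × ¬ IsPowerOf g u
  properOvergroup u notMaximal
    with FP.¬∀⟶∃¬ order _ (λ g → powerOf? u g →-dec powerOf? g u) notMaximal
  ... | g , ¬[u∈⟨g⟩⇒g∈⟨u⟩] with powerOf? u g
  ...   | yes u∈⟨g⟩ = g , u∈⟨g⟩ , λ g∈⟨u⟩ → ¬[u∈⟨g⟩⇒g∈⟨u⟩] (λ _ → g∈⟨u⟩)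
  ...   | no u∉⟨g⟩ = ⊥-elim (¬[u∈⟨g⟩⇒g∈⟨u⟩] (⊥-elim ∘ u∉⟨g⟩))

  ε-adj : ∀ {v} → v ≢ ε → PowerAdj ε v
  ε-adj v≢ε = v≢ε ∘ sym , inj₁ (0 , refl)

  adj-ε : ∀ {u} → u ≢ ε → PowerAdj u ε
  adj-ε u≢ε = u≢ε , inj₂ (0 , refl)

  adj-⁻¹ : ∀ {u} → u ⁻¹ ≢ u → PowerAdj u (u ⁻¹)
  adj-⁻¹ {u} u⁻¹≢u = u⁻¹≢u ∘ sym , inj₂ (inverse-is-power u)

  orient : Fin order → Fin 2
  orient v = below (toℕ v) (toℕ (v ⁻¹))

  orient-⁻¹ : ∀ v → v ⁻¹ ≢ v → orient (v ⁻¹) ≢ orient v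
  orient-⁻¹ v v⁻¹≢v same = below-flip (v⁻¹≢v ∘ FP.toℕ-injective)
    (trans (cong (λ t → below (toℕ (v ⁻¹)) (toℕ t)) (sym (⁻¹-involutive v))) same)

module UniqueMaximal (G : FinGroup) (x : Fin (FinGroup.order G))
  (x-max : FinGroup.IsMaximalInvolution G x)
  (x-unique : ∀ y → FinGroup.IsMaximalInvolution G y → y ≡ x) where

  open GroupFacts G
  open ≡-Reasoning

  xx : (x ∙ x) ≡ ε
  xx = proj₂ (proj₁ x-max)

  x⁻¹≡x : x ⁻¹ ≡ x
  x⁻¹≡x = involution-self-inverse xx

  -- x is central: g x g⁻¹ is a maximal involution, hence equal to x.
  x-central : ∀ g → (g ∙ x) ≡ (x ∙ g)
  x-central g = begin
    g ∙ x                       ≡⟨ cong (g ∙_) (sym (//-rightDividesˡ g x)) ⟩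
    g ∙ ((x ∙ (g ⁻¹)) ∙ g)      ≡⟨ sym (assoc g _ g) ⟩
    (conj g x) ∙ g              ≡⟨ cong (_∙ g) (x-unique _ (conj-maximal g x-max)) ⟩
    x ∙ g                       ∎

  x∙-≢ε : ∀ {g} → g ≢ x → (x ∙ g) ≢ ε
  x∙-≢ε g≢x xg≡ε = g≢x (trans (inverseʳ-unique x _ xg≡ε) x⁻¹≡x)

  x∙-≢x : ∀ {g} → g ≢ ε → (x ∙ g) ≢ x
  x∙-≢x g≢ε xg≡x = g≢ε (∙-cancelˡ x _ ε (trans xg≡x (sym (identityʳ x))))

  -- Take g ∉ {ε, x}: an odd order
  -- 2M+1 of g would give (x g)^(2M+1) = x, i.e. x ∈ ⟨x g⟩ with x g ∉ {ε, x};
  -- so some power of g is an involution, and it is not x because x ∉ ⟨g⟩.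
  secondInvolution : 3 ≤ order → ∃ λ y → IsInvolution y × y ≢ x
  secondInvolution 3≤n with avoidTwo 3≤n ε x
  ... | g , g≢ε , g≢x with period g
  ... | m , gᵐ⁺¹≡ε with oddPeriodOrInvolution g m gᵐ⁺¹≡ε
  ... | inj₂ (k , gᵏ-involution) =
        g ^ k , gᵏ-involution , λ gᵏ≡x → [ g≢ε , g≢x ] (maximal-overgroups x-max (k , sym gᵏ≡x))
  ... | inj₁ (M , g-odd) =
        ⊥-elim ([ x∙-≢ε g≢x , x∙-≢x g≢ε ] (maximal-overgroups x-max (suc (M + M) , sym x∈⟨xg⟩)))
    where
    x∈⟨xg⟩ : (x ∙ g) ^ suc (M + M) ≡ x
    x∈⟨xg⟩ = begin
      (x ∙ g) ^ suc (M + M)                       ≡⟨ ^-∙ (x-central g) (suc (M + M)) ⟩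
      (x ∙ (x ^ (M + M))) ∙ (g ^ suc (M + M))     ≡⟨ cong₂ (λ s t → (x ∙ s) ∙ t) (involution-even-power xx M) g-odd ⟩
      (x ∙ ε) ∙ ε                                 ≡⟨ identityʳ _ ⟩
      x ∙ ε                                       ≡⟨ identityʳ x ⟩
      x                                           ∎

  -- With fewer than three colours there is no rainbow colouring: for the
  -- involutions x, y and z = x y the edges ε–x, ε–y, ε–z need three colours.
  lowerBound : 3 ≤ order → ∀ k → k < 3 → ¬ RainbowColourable PowerAdj k
  lowerBound 3≤n k (s≤s k≤2) (c , c-symmetric , rainbow) with secondInvolution 3≤n
  ... | y , y-involution@(y≢ε , yy) , y≢x =
        noThreeDistinct k≤2 (c x ε) (c ε y) (c ε z)
          (differ (fromX y≢ε y≢x)) (differ (fromX z≢ε z≢x))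
          (λ same → differ yz-hub (trans (c-symmetric y ε (adj-ε y≢ε)) same))
    where
    open Hub PowerAdj ε

    z : Fin order
    z = x ∙ y

    zy≡x : (z ∙ y) ≡ x
    zy≡x = trans (assoc x y y) (trans (cong (x ∙_) yy) (identityʳ x))

    z≢ε : z ≢ ε
    z≢ε = x∙-≢ε y≢x

    z≢x : z ≢ x
    z≢x = x∙-≢x y≢ε

    z-involution : IsInvolution z
    z-involution = z≢ε , (begin
      (x ∙ y) ∙ (x ∙ y)   ≡⟨ assoc x y _ ⟩
      x ∙ (y ∙ (x ∙ y))   ≡⟨ cong (x ∙_) (sym (assoc y x y)) ⟩
      x ∙ ((y ∙ x) ∙ y)   ≡⟨ cong (λ t → x ∙ (t ∙ y)) (x-central y) ⟩
      x ∙ (z ∙ y)         ≡⟨ cong (x ∙_) zy≡x ⟩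
      x ∙ x               ≡⟨ xx ⟩
      ε                   ∎)

    fromX : ∀ {v} → v ≢ ε → v ≢ x → OnlyThroughHub x v
    fromX v≢ε v≢x = v≢x ∘ sym , v≢ε ∘ maximal-involution-neighbour x-max ,
                    λ x~w _ → maximal-involution-neighbour x-max x~w

    yz-hub : OnlyThroughHub y z
    yz-hub = (λ y≡z → x≢ε (∙-cancelʳ y x ε (trans (sym y≡z) (sym (identityˡ y))))) ,
             involutions-nonadjacent y-involution z-involution ,
             common-neighbour x-max y-involution z-involution y≢x zy≡x
      where x≢ε = proj₁ (proj₁ x-max)

    differ : ∀ {u v} → OnlyThroughHub u v → c u ε ≢ c ε v
    differ {u} {v} through = hub-colours-differ k≤2 c through (proj₁ (rainbow u v)) (proj₂ (proj₂ (rainbow u v)))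

  GoodNeighbour : Fin order → Set
  GoodNeighbour u = ∃ λ w → w ≢ ε × w ≢ x × PowerAdj u w × orient w ≢ orient u

  goodNeighbour-inverse : ∀ {u} → u ⁻¹ ≢ u → u ≢ ε → u ≢ x → GoodNeighbour u
  goodNeighbour-inverse {u} u⁻¹≢u u≢ε u≢x =
    u ⁻¹ , ⁻¹-≢ ε⁻¹≈ε u≢ε , ⁻¹-≢ x⁻¹≡x u≢x , adj-⁻¹ u⁻¹≢u , orient-⁻¹ u u⁻¹≢u

  -- For an involution u ≠ x with u ∈ ⟨g⟩ ≠ ⟨u⟩, one of g, g⁻¹ is a good
  -- neighbour: both are adjacent to u, and they have different orientations
  -- because g is not an involution.
  goodNeighbour-overgroup : ∀ {u g} → IsInvolution u → u ≢ x →
    IsPowerOf u g → ¬ IsPowerOf g u → GoodNeighbour u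
  goodNeighbour-overgroup {u} {g} (u≢ε , uu) u≢x u∈⟨g⟩ g∉⟨u⟩ = choose (orient g FP.≟ orient u)
    where
    u≢g : u ≢ g
    u≢g u≡g = g∉⟨u⟩ (1 , trans (sym u≡g) (sym (identityʳ u)))

    g≢ε : g ≢ ε
    g≢ε g≡ε = g∉⟨u⟩ (0 , g≡ε)

    g≢x : g ≢ x
    g≢x g≡x = [ u≢ε , u≢x ] (involution-powers xx (subst (IsPowerOf u) g≡x u∈⟨g⟩))

    g⁻¹≢g : g ⁻¹ ≢ g
    g⁻¹≢g g⁻¹≡g = [ u≢ε , u≢g ] (involution-powers (trans (cong (g ∙_) (sym g⁻¹≡g)) (inverseʳ g)) u∈⟨g⟩)

    u~g⁻¹ : PowerAdj u (g ⁻¹)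
    u~g⁻¹ = (λ u≡g⁻¹ → u≢g (sym (⁻¹-fixed (involution-self-inverse uu) (sym u≡g⁻¹)))) ,
            inj₁ (subst (λ t → IsPowerOf t (g ⁻¹)) (involution-self-inverse uu) (power-⁻¹ u∈⟨g⟩))

    choose : Dec (orient g ≡ orient u) → GoodNeighbour u
    choose (no differ) = g , g≢ε , g≢x , (u≢g , inj₁ u∈⟨g⟩) , differ
    choose (yes same) = g ⁻¹ , ⁻¹-≢ ε⁻¹≈ε g≢ε , ⁻¹-≢ x⁻¹≡x g≢x , u~g⁻¹ ,
                        λ same′ → orient-⁻¹ g g⁻¹≢g (trans same′ (sym same))

  -- An involution u ≠ x is not maximal, so it lies in some ⟨g⟩ ≠ ⟨u⟩.
  goodNeighbour-involution : ∀ {u} → IsInvolution u → u ≢ x → GoodNeighbour u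
  goodNeighbour-involution {u} u-involution u≢x =
    let g , u∈⟨g⟩ , g∉⟨u⟩ = properOvergroup u (λ u-max → u≢x (x-unique u (u-involution , u-max)))
    in goodNeighbour-overgroup u-involution u≢x u∈⟨g⟩ g∉⟨u⟩

  goodNeighbour : ∀ {u} → u ≢ ε → u ≢ x → GoodNeighbour u
  goodNeighbour {u} u≢ε u≢x with (u ⁻¹) FP.≟ u
  ... | no u⁻¹≢u = goodNeighbour-inverse u⁻¹≢u u≢ε u≢x
  ... | yes u⁻¹≡u = goodNeighbour-involution (u≢ε , trans (cong (u ∙_) (sym u⁻¹≡u)) (inverseʳ u)) u≢x

  spoke : Fin order → Fin 3
  spoke v with v FP.≟ x
  ... | yes _ = F.zero
  ... | no _ = F.suc (orient v)

  colour : Fin order → Fin order → Fin 3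
  colour u v with u FP.≟ ε | v FP.≟ ε
  ... | yes _ | _ = spoke v
  ... | no _ | yes _ = spoke u
  ... | no _ | no _ = F.zero

  colour-symmetric : ∀ u v → colour u v ≡ colour v u
  colour-symmetric u v with u FP.≟ ε | v FP.≟ ε
  ... | yes refl | yes refl = refl
  ... | yes _ | no _ = refl
  ... | no _ | yes _ = refl
  ... | no _ | no _ = refl

  colour-from-hub : ∀ v → colour ε v ≡ spoke v
  colour-from-hub v with ε FP.≟ ε
  ... | yes _ = refl
  ... | no ε≢ε = ⊥-elim (ε≢ε refl)

  colour-off-hub : ∀ {u v} → u ≢ ε → v ≢ ε → colour u v ≡ F.zero
  colour-off-hub {u} {v} u≢ε v≢ε with u FP.≟ ε | v FP.≟ ε
  ... | yes u≡ε | _ = ⊥-elim (u≢ε u≡ε)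
  ... | no _ | yes v≡ε = ⊥-elim (v≢ε v≡ε)
  ... | no _ | no _ = refl

  spoke-x : spoke x ≡ F.zero
  spoke-x with x FP.≟ x
  ... | yes _ = refl
  ... | no x≢x = ⊥-elim (x≢x refl)

  spoke-other : ∀ {v} → v ≢ x → spoke v ≡ F.suc (orient v)
  spoke-other {v} v≢x with v FP.≟ x
  ... | yes v≡x = ⊥-elim (v≢x v≡x)
  ... | no _ = refl

  colour-ε-x : colour ε x ≡ F.zero
  colour-ε-x = trans (colour-from-hub x) spoke-x

  colour-ε-v : ∀ {v} → v ≢ x → colour ε v ≡ F.suc (orient v)
  colour-ε-v {v} v≢x = trans (colour-from-hub v) (spoke-other v≢x)

  colour-v-ε : ∀ {v} → v ≢ x → colour v ε ≡ F.suc (orient v)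
  colour-v-ε {v} v≢x = trans (colour-symmetric v ε) (colour-ε-v v≢x)

  RainbowPath : Fin order → Fin order → Set
  RainbowPath u v = Σ (Walk PowerAdj u v) λ p → Unique (vertices p) × Unique (edgeColours colour p)

  edgePath : ∀ {u v} → PowerAdj u v → RainbowPath u v
  edgePath u~v = step u~v stop , unique₂ (proj₁ u~v) , unique₁

  hubPath : ∀ {u v} → u ≢ ε → v ≢ ε → u ≢ v → colour u ε ≢ colour ε v → RainbowPath u v
  hubPath u≢ε v≢ε u≢v differ =
    step (adj-ε u≢ε) (step (ε-adj v≢ε) stop) , unique₃ u≢ε u≢v (v≢ε ∘ sym) , unique₂ differ

  -- u–w–ε–v with colours 0, 1 + orient w, 1 + orient v
  detourPath : ∀ {u w v} → PowerAdj u w → u ≢ ε → w ≢ ε → v ≢ ε → u ≢ v → w ≢ v →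
    w ≢ x → v ≢ x → orient w ≢ orient v → RainbowPath u v
  detourPath u~w u≢ε w≢ε v≢ε u≢v w≢v w≢x v≢x differ =
    step u~w (step (adj-ε w≢ε) (step (ε-adj v≢ε) stop)) ,
    unique₄ (proj₁ u~w) u≢ε u≢v w≢ε w≢v (v≢ε ∘ sym) ,
    unique₃ (λ eq → FP.0≢1+n (trans (sym (colour-off-hub u≢ε w≢ε)) (trans eq (colour-v-ε w≢x))))
            (λ eq → FP.0≢1+n (trans (sym (colour-off-hub u≢ε w≢ε)) (trans eq (colour-ε-v v≢x))))
            (λ eq → differ (FP.suc-injective (trans (sym (colour-v-ε w≢x)) (trans eq (colour-ε-v v≢x)))))

  ordinaryPath : ∀ {u v} → u ≢ v → u ≢ ε → v ≢ ε → u ≢ x → v ≢ x → RainbowPath u v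
  ordinaryPath {u} {v} u≢v u≢ε v≢ε u≢x v≢x with orient u FP.≟ orient v
  ... | no differ = hubPath u≢ε v≢ε u≢v
          (λ eq → differ (FP.suc-injective (trans (sym (colour-v-ε u≢x)) (trans eq (colour-ε-v v≢x)))))
  ... | yes same with goodNeighbour u≢ε u≢x
  ...   | w , w≢ε , w≢x , u~w , w-other with w FP.≟ v
  ...     | yes refl = edgePath u~w
  ...     | no w≢v = detourPath u~w u≢ε w≢ε v≢ε u≢v w≢v w≢x v≢x (λ eq → w-other (trans eq (sym same)))

  -- Two vertices other than ε; one of them may be x, whose edge to ε has colour 0.
  pathAwayFromHub : ∀ {u v} → u ≢ v → u ≢ ε → v ≢ ε → RainbowPath u v
  pathAwayFromHub {u} {v} u≢v u≢ε v≢ε with u FP.≟ x | v FP.≟ x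
  ... | yes refl | _ = hubPath u≢ε v≢ε u≢v
          (λ eq → FP.0≢1+n (trans (sym (trans (colour-symmetric x ε) colour-ε-x))
                                  (trans eq (colour-ε-v (u≢v ∘ sym)))))
  ... | no u≢x | yes refl = hubPath u≢ε v≢ε u≢v
          (λ eq → FP.0≢1+n (trans (sym colour-ε-x) (trans (sym eq) (colour-v-ε u≢x))))
  ... | no u≢x | no v≢x = ordinaryPath u≢v u≢ε v≢ε u≢x v≢x

  rainbowPath : ∀ u v → RainbowPath u v
  rainbowPath u v with u FP.≟ v
  ... | yes refl = stop , unique₁ , []
  ... | no u≢v with u FP.≟ ε | v FP.≟ ε
  ...   | yes refl | _ = edgePath (ε-adj (u≢v ∘ sym))
  ...   | no u≢ε | yes refl = edgePath (adj-ε u≢ε)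
  ...   | no u≢ε | no v≢ε = pathAwayFromHub u≢v u≢ε v≢ε

  upperBound : RainbowColourable PowerAdj 3
  upperBound = colour , (λ u v _ → colour-symmetric u v) , rainbowPath

proposition2p8 : (G : FinGroup) → 3 ≤ FinGroup.order G →
    FinGroup.UniqueMaximalInvolution G →
    RainbowConnectionNumberIs (FinGroup.PowerAdj G) 3
proposition2p8 G 3≤n (x , x-max , x-unique) = upperBound , lowerBound 3≤n
  where open UniqueMaximal G x x-max x-unique
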